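{- Let $r,c,n$ be integers with $0\le r\le c\le n$, and let $M=M(n;r,c)$ and $M^*$ be the matrices defined in the context. Then: (i) if $n\ge r+c$, then $MM^*=I$; (ii) if $n\le r+c$, then $M^*M=I$.
   Context: Let $[n]=\{1,\dots,n\}$. The set inclusion incidence matrix $M=M(n;r,c)$ is the $\binom{n}{r}\times\binom{n}{c}$ real matrix whose rows are indexed by the $r$-subsets $R$ of $[n]$, whose columns are indexed by the $c$-subsets $C$ of $[n]$, and whose $(R,C)$-entry is $1$ if $R\subseteq C$ and $0$ otherwise. Let $N=\max\{n,r+c\}$. Let $M^*$ be the $\binom{n}{c}\times\binom{n}{r}$ matrix with rows indexed by $c$-subsets $C$ and columns indexed by $r$-subsets $R$ of $[n]$, with entries $$M^*_{C,R}=(-1)^{r-i}\frac{\binom{c-i-1}{r-i}}{\binom{N-r}{c-r}\binom{N-c}{r-i}},\qquad i=|R\cap C|.$$ Binomial coefficients $\binom{a}{b}$ with integer $a$ and integer $b\ge 0$ are understood as $a(a-1)\cdots(a-b+1)/b!$ (so e.g. $\binom{ -1}{0}=1$, and $\binom{a}{b}=0$ if $0\le a<b$). $I$ denotes the identity matrix of appropriate size. -}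

module Defs where

open import Data.Bool using (Bool; true; false; if_then_else_)
open import Data.Nat as ℕ using (ℕ; zero; suc; _⊔_; _∸_; _≡ᵇ_)
open import Data.Nat.Combinatorics using (_C_)
open import Data.Integer as ℤ using (ℤ; +_)
open import Data.Rational as ℚ using (ℚ; 0ℚ; 1ℚ; _/_; _*_; _+_; -_)
open import Data.Rational.Properties as ℚP using ()
open import Data.List using (List; []; _∷_; map; _++_; foldr)
open import Data.Vec using (Vec; []; _∷_)
open import Data.Fin.Subset using (Subset; ∣_∣; _∩_; _⊆_)
open import Data.Fin.Subset.Properties using (_⊆?_)
open import Relation.Nullary using (yes; no)
open import Relation.Binary.PropositionalEquality using (_≡_)
open import Data.Bool.Properties using () renaming (_≟_ to _≟B_)
open import Data.Vec.Properties using (≡-dec)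

ℤ→ℚ : ℤ → ℚ
ℤ→ℚ a = a / 1

ℕ→ℚ : ℕ → ℚ
ℕ→ℚ m = ℤ→ℚ (+ m)

-- total division on ℚ (only ever used with nonzero denominators here)
_÷'_ : ℚ → ℚ → ℚ
p ÷' q with q ℚP.≟ 0ℚ
... | yes _ = 0ℚ
... | no q≢0 = ℚ._÷_ p q {{ℚ.≢-nonZero q≢0}}

fall : ℤ → ℕ → ℚ
fall a zero = 1ℚ
fall a (suc k) = fall a k * ℤ→ℚ (a ℤ.- + k)

fact : ℕ → ℕ
fact zero = 1
fact (suc k) = suc k ℕ.* fact k

binom : ℤ → ℕ → ℚ
binom a k = fall a k ÷' ℕ→ℚ (fact k)

sgn : ℕ → ℚ
sgn zero = 1ℚ
sgn (suc k) = - sgn k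

subsets : (n : ℕ) → List (Subset n)
subsets zero = [] ∷ []
subsets (suc n) = map (true ∷_) (subsets n) ++ map (false ∷_) (subsets n)

sumℚ : List ℚ → ℚ
sumℚ = foldr _+_ 0ℚ

sumOver : (n c : ℕ) → (Subset n → ℚ) → ℚ
sumOver n c f = sumℚ (map (λ C → if ∣ C ∣ ≡ᵇ c then f C else 0ℚ) (subsets n))

M : (n r c : ℕ) → Subset n → Subset n → ℚ
M n r c R C with R ⊆? C
... | yes _ = 1ℚ
... | no _ = 0ℚ

bigN : (n r c : ℕ) → ℕ
bigN n r c = n ⊔ (r ℕ.+ c)

Mstar : (n r c : ℕ) → Subset n → Subset n → ℚ
Mstar n r c C R =
  (sgn (r ∸ i) * binom (+ c ℤ.- + i ℤ.- + 1) (r ∸ i))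
  ÷' (binom (+ (N ∸ r)) (c ∸ r) * binom (+ (N ∸ c)) (r ∸ i))
  where
    N = bigN n r c
    i = ∣ R ∩ C ∣

δ : {n : ℕ} → Subset n → Subset n → ℚ
δ X Y with ≡-dec _≟B_ X Y
... | yes _ = 1ℚ
... | no _ = 0ℚ

module Submission where

-- Sort [n] into the four cells of the Venn diagram of R and R′, of sizes α, β, γ, ε
-- (β = γ as ∣ R ∣ = ∣ R′ ∣).  M*_{C,R′} only depends on s = ∣ C ∩ (R′ ∖ R) ∣, and
-- C(γ,s) C(ε,c−r−s) sets C ⊇ R have a given s, so (M M*)_{R,R′} = Σₛ C(γ,s) C(ε,c−r−s) M*(α+s).
-- Put m = γ, b = c − r.  A trinomial revision turns the s-th term into
-- C(b,s) C(−b,m−s) / C(m+ε,m), and Vandermonde's convolution sums these to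
-- C(0,m) / C(m+ε,m) = [m = 0] = [R = R′].  Complementation C ↦ [n] ∖ C turns
-- M(n;r,c) into the transpose of M(n;n−c,n−r) and preserves M*, so (ii) follows from (i).

open import Defs
open import Data.Bool using (true; false; if_then_else_)
open import Data.Empty using (⊥-elim)
open import Data.Integer as ℤ using (ℤ; +_; 1ℤ)
import Data.Integer.Properties as ℤP
import Data.Integer.Tactic.RingSolver as ℤ-Solver
open import Data.Maybe using (Maybe; just; nothing)
import Data.Nat as ℕ
open ℕ using (ℕ; zero; suc; _≤_; _<_; z≤n; s≤s; _∸_; _≡ᵇ_; _!)
import Data.Nat.Properties as ℕP
import Data.Nat.Tactic.RingSolver as ℕ-Solver
import Data.Nat.Combinatorics.Specification as CSpec
open import Data.Nat.Coprimality as Coprime using ()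
open import Data.Rational as ℚ using (ℚ; 0ℚ; 1ℚ)
import Data.Rational.Properties as ℚP
open import Relation.Binary.PropositionalEquality
open import Relation.Nullary using (yes; no; Dec)
open import Relation.Nullary.Decidable using (dec-true; dec-false)
open import Tactic.RingSolver.Core.AlmostCommutativeRing using (AlmostCommutativeRing; fromCommutativeRing)

module Rationals where
  open import Data.Rational using (_+_; _*_; -_; _-_; mkℚ)
  open import Tactic.RingSolver using (solve-∀)
  open ≡-Reasoning

  ℚ-ring : AlmostCommutativeRing _ _
  ℚ-ring = fromCommutativeRing ℚP.+-*-commutativeRing is-zero
    where
    is-zero : ∀ x → Maybe (0ℚ ≡ x)
    is-zero x with 0ℚ ℚP.≟ x
    ... | yes p = just p
    ... | no _ = nothing

  *-interchange : ∀ w x y z → w * x * (y * z) ≡ w * y * (x * z)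
  *-interchange = solve-∀ ℚ-ring

  ℤ→ℚ≡mkℚ : ∀ a → ℤ→ℚ a ≡ mkℚ a 0 (Coprime.sym (Coprime.1-coprimeTo ℤ.∣ a ∣))
  ℤ→ℚ≡mkℚ a = ℚP.↥p/↧p≡p (mkℚ a 0 (Coprime.sym (Coprime.1-coprimeTo ℤ.∣ a ∣)))

  ℤ→ℚ-+ : ∀ a b → ℤ→ℚ (a ℤ.+ b) ≡ ℤ→ℚ a + ℤ→ℚ b
  ℤ→ℚ-+ a b rewrite ℤ→ℚ≡mkℚ a | ℤ→ℚ≡mkℚ b =
    cong (ℚ._/ 1) (cong₂ ℤ._+_ (sym (ℤP.*-identityʳ a)) (sym (ℤP.*-identityʳ b)))

  ℤ→ℚ-* : ∀ a b → ℤ→ℚ (a ℤ.* b) ≡ ℤ→ℚ a * ℤ→ℚ b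
  ℤ→ℚ-* a b rewrite ℤ→ℚ≡mkℚ a | ℤ→ℚ≡mkℚ b = refl

  ℤ→ℚ-neg : ∀ a → ℤ→ℚ (ℤ.- a) ≡ - ℤ→ℚ a
  ℤ→ℚ-neg a rewrite ℤ→ℚ≡mkℚ a | ℤ→ℚ≡mkℚ (ℤ.- a) with a
  ... | + zero = refl
  ... | ℤ.+[1+ n ] = refl
  ... | ℤ.-[1+ n ] = refl

  ℤ→ℚ-- : ∀ a b → ℤ→ℚ (a ℤ.- b) ≡ ℤ→ℚ a - ℤ→ℚ b
  ℤ→ℚ-- a b = trans (ℤ→ℚ-+ a (ℤ.- b)) (cong (λ q → ℤ→ℚ a + q) (ℤ→ℚ-neg b))

  ℕ→ℚ-+ : ∀ m n → ℕ→ℚ (m ℕ.+ n) ≡ ℕ→ℚ m + ℕ→ℚ n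
  ℕ→ℚ-+ m n = trans (cong ℤ→ℚ (ℤP.pos-+ m n)) (ℤ→ℚ-+ (+ m) (+ n))

  ℕ→ℚ-* : ∀ m n → ℕ→ℚ (m ℕ.* n) ≡ ℕ→ℚ m * ℕ→ℚ n
  ℕ→ℚ-* m n = trans (cong ℤ→ℚ (ℤP.pos-* m n)) (ℤ→ℚ-* (+ m) (+ n))

  ℕ→ℚ-injective : ∀ {m n} → ℕ→ℚ m ≡ ℕ→ℚ n → m ≡ n
  ℕ→ℚ-injective {m} {n} eq rewrite ℤ→ℚ≡mkℚ (+ m) | ℤ→ℚ≡mkℚ (+ n) =
    ℤP.+-injective (cong ℚ.numerator eq)

  ℕ→ℚ-pos⇒≢0 : ∀ {m} → 0 < m → ℕ→ℚ m ≢ 0ℚ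
  ℕ→ℚ-pos⇒≢0 {suc m} _ eq with ℕ→ℚ-injective {suc m} {0} eq
  ... | ()

  -- The inverse behind _÷'_; it is total, with inv 0ℚ = 0ℚ.
  inv : ℚ → ℚ
  inv q = 1ℚ ÷' q

  ÷'≡*inv : ∀ p q → p ÷' q ≡ p * inv q
  ÷'≡*inv p q with q ℚP.≟ 0ℚ
  ... | yes _ = sym (ℚP.*-zeroʳ p)
  ... | no _ = cong (p *_) (sym (ℚP.*-identityˡ _))

  *-inv≡1 : ∀ q → q ≢ 0ℚ → q * inv q ≡ 1ℚ
  *-inv≡1 q q≢0 with q ℚP.≟ 0ℚ
  ... | yes q≡0 = ⊥-elim (q≢0 q≡0)
  ... | no q≢0′ = trans (cong (q *_) (ℚP.*-identityˡ _)) (ℚP.*-inverseʳ q {{ℚ.≢-nonZero q≢0′}})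

  inv*≡1 : ∀ q → q ≢ 0ℚ → inv q * q ≡ 1ℚ
  inv*≡1 q q≢0 = trans (ℚP.*-comm (inv q) q) (*-inv≡1 q q≢0)

  inv-unique : ∀ q a → q ≢ 0ℚ → q * a ≡ 1ℚ → inv q ≡ a
  inv-unique q a q≢0 qa≡1 = begin
    inv q              ≡⟨ sym (ℚP.*-identityʳ _) ⟩
    inv q * 1ℚ         ≡⟨ cong (inv q *_) (sym qa≡1) ⟩
    inv q * (q * a)    ≡⟨ sym (ℚP.*-assoc (inv q) q a) ⟩
    (inv q * q) * a    ≡⟨ cong (_* a) (inv*≡1 q q≢0) ⟩
    1ℚ * a             ≡⟨ ℚP.*-identityˡ a ⟩
    a                  ∎

  inv-* : ∀ x y → inv (x * y) ≡ inv x * inv y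
  inv-* x y = by-cases (x ℚP.≟ 0ℚ) (y ℚP.≟ 0ℚ)
    where
    by-cases : Dec (x ≡ 0ℚ) → Dec (y ≡ 0ℚ) → inv (x * y) ≡ inv x * inv y
    by-cases (yes refl) _ = trans (cong inv (ℚP.*-zeroˡ y)) (sym (ℚP.*-zeroˡ (inv y)))
    by-cases (no _) (yes refl) = trans (cong inv (ℚP.*-zeroʳ x)) (sym (ℚP.*-zeroʳ (inv x)))
    by-cases (no x≢0) (no y≢0) = inv-unique (x * y) (inv x * inv y) xy≢0 (begin
      x * y * (inv x * inv y)     ≡⟨ *-interchange x y (inv x) (inv y) ⟩
      x * inv x * (y * inv y)     ≡⟨ cong₂ _*_ (*-inv≡1 x x≢0) (*-inv≡1 y y≢0) ⟩
      1ℚ                          ∎)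
      where
      xy≢0 : x * y ≢ 0ℚ
      xy≢0 xy≡0 = y≢0 (begin
        y                  ≡⟨ sym (ℚP.*-identityˡ y) ⟩
        1ℚ * y             ≡⟨ cong (_* y) (sym (inv*≡1 x x≢0)) ⟩
        (inv x * x) * y    ≡⟨ ℚP.*-assoc (inv x) x y ⟩
        inv x * (x * y)    ≡⟨ cong (inv x *_) xy≡0 ⟩
        inv x * 0ℚ         ≡⟨ ℚP.*-zeroʳ (inv x) ⟩
        0ℚ                 ∎)

  p*a≡q*d⇒p*inv[d]≡q*inv[a] : ∀ {p q a d} → a ≢ 0ℚ → d ≢ 0ℚ → p * a ≡ q * d → p * inv d ≡ q * inv a
  p*a≡q*d⇒p*inv[d]≡q*inv[a] {p} {q} {a} {d} a≢0 d≢0 pa≡qd = begin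
    p * inv d                   ≡⟨ sym (ℚP.*-identityʳ _) ⟩
    p * inv d * 1ℚ              ≡⟨ cong (p * inv d *_) (sym (*-inv≡1 a a≢0)) ⟩
    p * inv d * (a * inv a)     ≡⟨ *-interchange p (inv d) a (inv a) ⟩
    p * a * (inv d * inv a)     ≡⟨ cong (_* (inv d * inv a)) pa≡qd ⟩
    q * d * (inv d * inv a)     ≡⟨ rotate q d (inv d) (inv a) ⟩
    q * inv a * (d * inv d)     ≡⟨ cong (q * inv a *_) (*-inv≡1 d d≢0) ⟩
    q * inv a * 1ℚ              ≡⟨ ℚP.*-identityʳ _ ⟩
    q * inv a                   ∎
    where
    rotate : ∀ w x y z → w * x * (y * z) ≡ w * z * (x * y)
    rotate = solve-∀ ℚ-ring

module GeneralisedBinomial where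
  open Rationals
  open import Data.Nat.Combinatorics using (_C_; nCk+nC[k+1]≡[n+1]C[k+1])
  open import Data.Rational using (_+_; _*_; -_; _-_)
  open import Tactic.RingSolver using (solve-∀)
  open ≡-Reasoning

  binom≡fall*inv : ∀ z t → binom z t ≡ fall z t * inv (ℕ→ℚ (fact t))
  binom≡fall*inv z t = ÷'≡*inv (fall z t) (ℕ→ℚ (fact t))

  fall-suc : ∀ z t → fall (z ℤ.+ 1ℤ) (suc t) ≡ ℤ→ℚ (z ℤ.+ 1ℤ) * fall z t
  fall-suc z zero = begin
    1ℚ * ℤ→ℚ (z ℤ.+ 1ℤ ℤ.- + 0)  ≡⟨ ℚP.*-identityˡ _ ⟩
    ℤ→ℚ (z ℤ.+ 1ℤ ℤ.- + 0)       ≡⟨ cong ℤ→ℚ (ℤP.+-identityʳ (z ℤ.+ 1ℤ)) ⟩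
    ℤ→ℚ (z ℤ.+ 1ℤ)               ≡⟨ sym (ℚP.*-identityʳ _) ⟩
    ℤ→ℚ (z ℤ.+ 1ℤ) * 1ℚ          ∎
  fall-suc z (suc t) = begin
    fall (z ℤ.+ 1ℤ) (suc t) * ℤ→ℚ (z ℤ.+ 1ℤ ℤ.- + suc t)
      ≡⟨ cong₂ _*_ (fall-suc z t) (cong ℤ→ℚ (shift z t)) ⟩
    ℤ→ℚ (z ℤ.+ 1ℤ) * fall z t * ℤ→ℚ (z ℤ.- + t)
      ≡⟨ ℚP.*-assoc (ℤ→ℚ (z ℤ.+ 1ℤ)) (fall z t) (ℤ→ℚ (z ℤ.- + t)) ⟩
    ℤ→ℚ (z ℤ.+ 1ℤ) * (fall z t * ℤ→ℚ (z ℤ.- + t)) ∎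
    where
    shift : ∀ z t → z ℤ.+ 1ℤ ℤ.- + suc t ≡ z ℤ.- + t
    shift z t = trans (cong (λ u → z ℤ.+ 1ℤ ℤ.- u) (ℤP.pos-+ 1 t)) (cancel z (+ t))
      where
      cancel : ∀ (z t : ℤ) → z ℤ.+ 1ℤ ℤ.- (1ℤ ℤ.+ t) ≡ z ℤ.- t
      cancel = ℤ-Solver.solve-∀

  inv-fact-suc : ∀ t → inv (ℕ→ℚ (fact (suc t))) ≡ inv (ℕ→ℚ (suc t)) * inv (ℕ→ℚ (fact t))
  inv-fact-suc t = trans (cong inv (ℕ→ℚ-* (suc t) (fact t))) (inv-* (ℕ→ℚ (suc t)) (ℕ→ℚ (fact t)))

  binom-pascal : ∀ z t → binom (z ℤ.+ 1ℤ) (suc t) ≡ binom z t + binom z (suc t)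
  binom-pascal z t = begin
    binom (z ℤ.+ 1ℤ) (suc t)
      ≡⟨ binom≡fall*inv (z ℤ.+ 1ℤ) (suc t) ⟩
    fall (z ℤ.+ 1ℤ) (suc t) * inv (ℕ→ℚ (fact (suc t)))
      ≡⟨ cong₂ _*_ (trans (fall-suc z t) (cong (_* F) (ℤ→ℚ-+ z 1ℤ))) (inv-fact-suc t) ⟩
    (Z + 1ℚ) * F * (I₁ * I)
      ≡⟨ split Z T F I I₁ ⟩
    F * I * ((1ℚ + T) * I₁) + F * (Z - T) * (I₁ * I)
      ≡⟨ cong₂ _+_ (cong (F * I *_) t+1/t+1≡1) (cong₂ _*_ (cong (F *_) (sym (ℤ→ℚ-- z (+ t)))) (sym (inv-fact-suc t))) ⟩
    F * I * 1ℚ + F * ℤ→ℚ (z ℤ.- + t) * inv (ℕ→ℚ (fact (suc t)))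
      ≡⟨ cong₂ _+_ (trans (ℚP.*-identityʳ _) (sym (binom≡fall*inv z t))) (sym (binom≡fall*inv z (suc t))) ⟩
    binom z t + binom z (suc t) ∎
    where
    Z = ℤ→ℚ z
    T = ℕ→ℚ t
    F = fall z t
    I = inv (ℕ→ℚ (fact t))
    I₁ = inv (ℕ→ℚ (suc t))
    split : ∀ Z T F I I₁ → (Z + 1ℚ) * F * (I₁ * I) ≡ F * I * ((1ℚ + T) * I₁) + F * (Z - T) * (I₁ * I)
    split = solve-∀ ℚ-ring
    t+1/t+1≡1 : (1ℚ + T) * I₁ ≡ 1ℚ
    t+1/t+1≡1 = trans (cong (_* I₁) (sym (ℕ→ℚ-+ 1 t))) (*-inv≡1 (ℕ→ℚ (suc t)) (ℕ→ℚ-pos⇒≢0 {suc t} (s≤s z≤n)))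

  binom-0-suc : ∀ m → binom (+ 0) (suc m) ≡ 0ℚ
  binom-0-suc m = begin
    binom (+ 0) (suc m)       ≡⟨ binom≡fall*inv (+ 0) (suc m) ⟩
    fall (+ 0) (suc m) * I    ≡⟨ cong (_* I) (fall-0-suc m) ⟩
    0ℚ * I                    ≡⟨ ℚP.*-zeroˡ I ⟩
    0ℚ                        ∎
    where
    I = inv (ℕ→ℚ (fact (suc m)))
    fall-0-suc : ∀ m → fall (+ 0) (suc m) ≡ 0ℚ
    fall-0-suc zero = refl
    fall-0-suc (suc m) = trans (cong (_* ℤ→ℚ (+ 0 ℤ.- + suc m)) (fall-0-suc m)) (ℚP.*-zeroˡ (ℤ→ℚ (+ 0 ℤ.- + suc m)))

  +suc≡+1 : ∀ n → + suc n ≡ + n ℤ.+ 1ℤ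
  +suc≡+1 n = trans (cong +_ (ℕP.+-comm 1 n)) (ℤP.pos-+ n 1)

  binom-ℕ : ∀ a k → binom (+ a) k ≡ ℕ→ℚ (a C k)
  binom-ℕ a zero = refl
  binom-ℕ zero (suc k) = binom-0-suc k
  binom-ℕ (suc a) (suc k) = begin
    binom (+ suc a) (suc k)              ≡⟨ cong (λ u → binom u (suc k)) (+suc≡+1 a) ⟩
    binom (+ a ℤ.+ 1ℤ) (suc k)           ≡⟨ binom-pascal (+ a) k ⟩
    binom (+ a) k + binom (+ a) (suc k)  ≡⟨ cong₂ _+_ (binom-ℕ a k) (binom-ℕ a (suc k)) ⟩
    ℕ→ℚ (a C k) + ℕ→ℚ (a C suc k)        ≡⟨ sym (ℕ→ℚ-+ (a C k) (a C suc k)) ⟩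
    ℕ→ℚ (a C k ℕ.+ a C suc k)            ≡⟨ cong ℕ→ℚ (nCk+nC[k+1]≡[n+1]C[k+1] a k) ⟩
    ℕ→ℚ (suc a C suc k)                  ∎

  fall-neg : ∀ x t → fall (ℤ.- x) t ≡ sgn t * fall (x ℤ.+ + t ℤ.- 1ℤ) t
  fall-neg x zero = refl
  fall-neg x (suc t) = begin
    fall (ℤ.- x) t * ℤ→ℚ (ℤ.- x ℤ.- + t)
      ≡⟨ cong₂ _*_ (fall-neg x t) (trans (cong ℤ→ℚ (negate x (+ t))) (ℤ→ℚ-neg (y ℤ.+ 1ℤ))) ⟩
    sgn t * fall y t * (- ℤ→ℚ (y ℤ.+ 1ℤ))
      ≡⟨ pull-sign (sgn t) (fall y t) (ℤ→ℚ (y ℤ.+ 1ℤ)) ⟩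
    - sgn t * (ℤ→ℚ (y ℤ.+ 1ℤ) * fall y t)
      ≡⟨ cong (- sgn t *_) (sym (fall-suc y t)) ⟩
    - sgn t * fall (y ℤ.+ 1ℤ) (suc t)
      ≡⟨ cong (λ u → - sgn t * fall u (suc t)) (sym (trans (cong (λ v → x ℤ.+ v ℤ.- 1ℤ) (ℤP.pos-+ 1 t)) (reassoc x (+ t)))) ⟩
    - sgn t * fall (x ℤ.+ + suc t ℤ.- 1ℤ) (suc t) ∎
    where
    y = x ℤ.+ + t ℤ.- 1ℤ
    negate : ∀ (x t : ℤ) → ℤ.- x ℤ.- t ≡ ℤ.- (x ℤ.+ t ℤ.- 1ℤ ℤ.+ 1ℤ)
    negate = ℤ-Solver.solve-∀
    reassoc : ∀ (x t : ℤ) → x ℤ.+ (1ℤ ℤ.+ t) ℤ.- 1ℤ ≡ x ℤ.+ t ℤ.- 1ℤ ℤ.+ 1ℤ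
    reassoc = ℤ-Solver.solve-∀
    pull-sign : ∀ (s F w : ℚ) → s * F * (- w) ≡ - s * (w * F)
    pull-sign = solve-∀ ℚ-ring

  binom-neg : ∀ x t → binom (ℤ.- x) t ≡ sgn t * binom (x ℤ.+ + t ℤ.- 1ℤ) t
  binom-neg x t = begin
    binom (ℤ.- x) t                      ≡⟨ binom≡fall*inv (ℤ.- x) t ⟩
    fall (ℤ.- x) t * I                   ≡⟨ cong (_* I) (fall-neg x t) ⟩
    sgn t * fall (x ℤ.+ + t ℤ.- 1ℤ) t * I  ≡⟨ ℚP.*-assoc (sgn t) _ I ⟩
    sgn t * (fall (x ℤ.+ + t ℤ.- 1ℤ) t * I) ≡⟨ cong (sgn t *_) (sym (binom≡fall*inv _ t)) ⟩
    sgn t * binom (x ℤ.+ + t ℤ.- 1ℤ) t   ∎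
    where I = inv (ℕ→ℚ (fact t))

module BinomialSums where
  open Rationals
  open import Data.Nat.Combinatorics using (_C_; nCk+nC[k+1]≡[n+1]C[k+1])
  open GeneralisedBinomial
  open import Data.Rational using (_+_; _*_)
  open import Algebra.Bundles using (CommutativeMonoid)
  open import Algebra.Properties.CommutativeSemigroup
    (CommutativeMonoid.commutativeSemigroup ℚP.+-0-commutativeMonoid)
    using () renaming (interchange to +-interchange)
  open ≡-Reasoning

  -- binomialSum k f = Σⱼ (k C j) · f j, written with the Pascal recursion.
  binomialSum : ℕ → (ℕ → ℚ) → ℚ
  binomialSum zero f = f 0
  binomialSum (suc k) f = binomialSum k f + binomialSum k (λ j → f (suc j))

  binomialSum-cong : ∀ k {f g : ℕ → ℚ} → (∀ j → j ≤ k → f j ≡ g j) → binomialSum k f ≡ binomialSum k g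
  binomialSum-cong zero f≡g = f≡g 0 z≤n
  binomialSum-cong (suc k) f≡g =
    cong₂ _+_ (binomialSum-cong k (λ j j≤k → f≡g j (ℕP.m≤n⇒m≤1+n j≤k)))
              (binomialSum-cong k (λ j j≤k → f≡g (suc j) (s≤s j≤k)))

  binomialSum-+ : ∀ k (f g : ℕ → ℚ) → binomialSum k (λ j → f j + g j) ≡ binomialSum k f + binomialSum k g
  binomialSum-+ zero f g = refl
  binomialSum-+ (suc k) f g = trans
    (cong₂ _+_ (binomialSum-+ k f g) (binomialSum-+ k (λ j → f (suc j)) (λ j → g (suc j))))
    (+-interchange (binomialSum k f) _ _ _)

  binomialSum-* : ∀ k (a : ℚ) (f : ℕ → ℚ) → binomialSum k (λ j → a * f j) ≡ a * binomialSum k f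
  binomialSum-* zero a f = refl
  binomialSum-* (suc k) a f =
    trans (cong₂ _+_ (binomialSum-* k a f) (binomialSum-* k a (λ j → f (suc j))))
          (sym (ℚP.*-distribˡ-+ a _ _))

  binomialSum-zero : ∀ k (f : ℕ → ℚ) → (∀ j → j ≤ k → f j ≡ 0ℚ) → binomialSum k f ≡ 0ℚ
  binomialSum-zero zero f f≡0 = f≡0 0 z≤n
  binomialSum-zero (suc k) f f≡0 =
    cong₂ _+_ (binomialSum-zero k f (λ j j≤k → f≡0 j (ℕP.m≤n⇒m≤1+n j≤k)))
              (binomialSum-zero k (λ j → f (suc j)) (λ j j≤k → f≡0 (suc j) (s≤s j≤k)))

  binomialSum-top : ∀ k (f : ℕ → ℚ) → (∀ j → j < k → f j ≡ 0ℚ) → binomialSum k f ≡ f k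
  binomialSum-top zero f _ = refl
  binomialSum-top (suc k) f f≡0 = trans
    (cong₂ _+_ (binomialSum-zero k f (λ j j≤k → f≡0 j (s≤s j≤k)))
               (binomialSum-top k (λ j → f (suc j)) (λ j j<k → f≡0 (suc j) (s≤s j<k))))
    (ℚP.+-identityˡ _)

  sumBelow : ℕ → (ℕ → ℚ) → ℚ
  sumBelow zero f = 0ℚ
  sumBelow (suc L) f = f 0 + sumBelow L (λ j → f (suc j))

  sumBelow-cong : ∀ L {f g : ℕ → ℚ} → (∀ j → j < L → f j ≡ g j) → sumBelow L f ≡ sumBelow L g
  sumBelow-cong zero _ = refl
  sumBelow-cong (suc L) f≡g = cong₂ _+_ (f≡g 0 (s≤s z≤n)) (sumBelow-cong L (λ j j<L → f≡g (suc j) (s≤s j<L)))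

  sumBelow-+ : ∀ L (f g : ℕ → ℚ) → sumBelow L (λ j → f j + g j) ≡ sumBelow L f + sumBelow L g
  sumBelow-+ zero f g = refl
  sumBelow-+ (suc L) f g = trans
    (cong (λ s → (f 0 + g 0) + s) (sumBelow-+ L (λ j → f (suc j)) (λ j → g (suc j))))
    (+-interchange (f 0) (g 0) _ _)

  sumBelow-zero : ∀ L (f : ℕ → ℚ) → (∀ j → f j ≡ 0ℚ) → sumBelow L f ≡ 0ℚ
  sumBelow-zero zero f _ = refl
  sumBelow-zero (suc L) f f≡0 = cong₂ _+_ (f≡0 0) (sumBelow-zero L (λ j → f (suc j)) (λ j → f≡0 (suc j)))

  binomialSum≡sumBelow : ∀ k L (f : ℕ → ℚ) → k < L → binomialSum k f ≡ sumBelow L (λ j → ℕ→ℚ (k C j) * f j)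
  binomialSum≡sumBelow zero (suc L) f _ = begin
    f 0                                              ≡⟨ sym (ℚP.*-identityˡ (f 0)) ⟩
    1ℚ * f 0                                         ≡⟨ sym (ℚP.+-identityʳ _) ⟩
    1ℚ * f 0 + 0ℚ                                    ≡⟨ cong (λ q → 1ℚ * f 0 + q) (sym (sumBelow-zero L _ (λ j → ℚP.*-zeroˡ (f (suc j))))) ⟩
    1ℚ * f 0 + sumBelow L (λ j → 0ℚ * f (suc j))     ∎
  binomialSum≡sumBelow (suc k) (suc L) f (s≤s k<L) = begin
    binomialSum k f + binomialSum k (λ j → f (suc j))
      ≡⟨ cong₂ _+_ (binomialSum≡sumBelow k (suc L) f (ℕP.m<n⇒m<1+n k<L))
                   (binomialSum≡sumBelow k L (λ j → f (suc j)) k<L) ⟩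
    (1ℚ * f 0 + sumBelow L (λ j → ℕ→ℚ (k C suc j) * f (suc j))) + sumBelow L (λ j → ℕ→ℚ (k C j) * f (suc j))
      ≡⟨ ℚP.+-assoc (1ℚ * f 0) _ _ ⟩
    1ℚ * f 0 + (sumBelow L (λ j → ℕ→ℚ (k C suc j) * f (suc j)) + sumBelow L (λ j → ℕ→ℚ (k C j) * f (suc j)))
      ≡⟨ cong (λ q → 1ℚ * f 0 + q) (sym (sumBelow-+ L _ _)) ⟩
    1ℚ * f 0 + sumBelow L (λ j → ℕ→ℚ (k C suc j) * f (suc j) + ℕ→ℚ (k C j) * f (suc j))
      ≡⟨ cong (λ q → 1ℚ * f 0 + q) (sumBelow-cong L (λ j _ → pascal j)) ⟩
    1ℚ * f 0 + sumBelow L (λ j → ℕ→ℚ (suc k C suc j) * f (suc j)) ∎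
    where
    pascal : ∀ j → ℕ→ℚ (k C suc j) * f (suc j) + ℕ→ℚ (k C j) * f (suc j) ≡ ℕ→ℚ (suc k C suc j) * f (suc j)
    pascal j = begin
      ℕ→ℚ (k C suc j) * f (suc j) + ℕ→ℚ (k C j) * f (suc j)  ≡⟨ sym (ℚP.*-distribʳ-+ (f (suc j)) (ℕ→ℚ (k C suc j)) (ℕ→ℚ (k C j))) ⟩
      (ℕ→ℚ (k C suc j) + ℕ→ℚ (k C j)) * f (suc j)            ≡⟨ cong (_* f (suc j)) (sym (ℕ→ℚ-+ (k C suc j) (k C j))) ⟩
      ℕ→ℚ (k C suc j ℕ.+ k C j) * f (suc j)                  ≡⟨ cong (λ n → ℕ→ℚ n * f (suc j)) (ℕP.+-comm (k C suc j) (k C j)) ⟩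
      ℕ→ℚ (k C j ℕ.+ k C suc j) * f (suc j)                  ≡⟨ cong (λ n → ℕ→ℚ n * f (suc j)) (nCk+nC[k+1]≡[n+1]C[k+1] k j) ⟩
      ℕ→ℚ (suc k C suc j) * f (suc j)                        ∎

  binomialSum-reweight : ∀ m b (f g : ℕ → ℚ) →
    (∀ s → s ≤ m → ℕ→ℚ (m C s) * f s ≡ ℕ→ℚ (b C s) * g s) → (∀ s → m < s → g s ≡ 0ℚ) →
    binomialSum m f ≡ binomialSum b g
  binomialSum-reweight m b f g same-term g-vanishes = begin
    binomialSum m f                           ≡⟨ binomialSum≡sumBelow m L f (s≤s (ℕP.m≤m⊔n m b)) ⟩
    sumBelow L (λ s → ℕ→ℚ (m C s) * f s)      ≡⟨ sumBelow-cong L (λ s _ → term s) ⟩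
    sumBelow L (λ s → ℕ→ℚ (b C s) * g s)      ≡⟨ sym (binomialSum≡sumBelow b L g (s≤s (ℕP.m≤n⊔m m b))) ⟩
    binomialSum b g                           ∎
    where
    L = suc (m ℕ.⊔ b)
    term : ∀ s → ℕ→ℚ (m C s) * f s ≡ ℕ→ℚ (b C s) * g s
    term s = by-cases (s ℕP.≤? m)
      where
      by-cases : Dec (s ≤ m) → ℕ→ℚ (m C s) * f s ≡ ℕ→ℚ (b C s) * g s
      by-cases (yes s≤m) = same-term s s≤m
      by-cases (no s≰m) = begin
        ℕ→ℚ (m C s) * f s   ≡⟨ cong (λ n → ℕ→ℚ n * f s) (CSpec.k>n⇒nCk≡0 (ℕP.≰⇒> s≰m)) ⟩
        0ℚ * f s            ≡⟨ ℚP.*-zeroˡ (f s) ⟩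
        0ℚ                  ≡⟨ sym (ℚP.*-zeroʳ (ℕ→ℚ (b C s))) ⟩
        ℕ→ℚ (b C s) * 0ℚ    ≡⟨ cong (ℕ→ℚ (b C s) *_) (sym (g-vanishes s (ℕP.≰⇒> s≰m))) ⟩
        ℕ→ℚ (b C s) * g s   ∎

  -- binomShift y m s is the coefficient of xᵐ in xˢ (1 + x)ʸ.
  binomShift : ℤ → ℕ → ℕ → ℚ
  binomShift y m zero = binom y m
  binomShift y zero (suc s) = 0ℚ
  binomShift y (suc m) (suc s) = binomShift y m s

  binomShift-≤ : ∀ y {m s} → s ≤ m → binomShift y m s ≡ binom y (m ∸ s)
  binomShift-≤ y z≤n = refl
  binomShift-≤ y (s≤s s≤m) = binomShift-≤ y s≤m

  binomShift-> : ∀ y {m s} → m < s → binomShift y m s ≡ 0ℚ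
  binomShift-> y {zero} {suc s} _ = refl
  binomShift-> y {suc m} {suc s} (s≤s m<s) = binomShift-> y m<s

  binomShift-+ : ∀ y k m s → binomShift y (k ℕ.+ m) (k ℕ.+ s) ≡ binomShift y m s
  binomShift-+ y zero m s = refl
  binomShift-+ y (suc k) m s = binomShift-+ y k m s

  binomShift-pascal : ∀ y m s → binomShift (y ℤ.+ 1ℤ) m s ≡ binomShift y m s + binomShift y m (suc s)
  binomShift-pascal y zero zero = sym (ℚP.+-identityʳ 1ℚ)
  binomShift-pascal y (suc m) zero = trans (binom-pascal y m) (ℚP.+-comm (binom y m) _)
  binomShift-pascal y zero (suc s) = sym (ℚP.+-identityʳ 0ℚ)
  binomShift-pascal y (suc m) (suc s) = binomShift-pascal y m s

  vandermonde : ∀ b y m → binomialSum b (binomShift y m) ≡ binom (y ℤ.+ + b) m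
  vandermonde zero y m = cong (λ z → binom z m) (sym (ℤP.+-identityʳ y))
  vandermonde (suc b) y m = begin
    binomialSum b (binomShift y m) + binomialSum b (λ s → binomShift y m (suc s))
      ≡⟨ sym (binomialSum-+ b _ _) ⟩
    binomialSum b (λ s → binomShift y m s + binomShift y m (suc s))
      ≡⟨ binomialSum-cong b (λ s _ → sym (binomShift-pascal y m s)) ⟩
    binomialSum b (binomShift (y ℤ.+ 1ℤ) m)
      ≡⟨ vandermonde b (y ℤ.+ 1ℤ) m ⟩
    binom (y ℤ.+ 1ℤ ℤ.+ + b) m
      ≡⟨ cong (λ z → binom z m) (trans (ℤP.+-assoc y 1ℤ (+ b)) (cong (λ z → y ℤ.+ z) (ℤP.+-comm 1ℤ (+ b)))) ⟩
    binom (y ℤ.+ (+ b ℤ.+ 1ℤ)) m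
      ≡⟨ cong (λ z → binom (y ℤ.+ z) m) (sym (+suc≡+1 b)) ⟩
    binom (y ℤ.+ + suc b) m ∎

  indicator≡binomShift : ∀ d c (v : ℚ) → (if d ≡ᵇ c then v else 0ℚ) ≡ binomShift (+ 0) c d * v
  indicator≡binomShift zero zero v = sym (ℚP.*-identityˡ v)
  indicator≡binomShift zero (suc c) v = sym (trans (cong (_* v) (binom-0-suc c)) (ℚP.*-zeroˡ v))
  indicator≡binomShift (suc d) zero v = sym (ℚP.*-zeroˡ v)
  indicator≡binomShift (suc d) (suc c) v = indicator≡binomShift d c v

  binomialSum-indicator : ∀ e d c (v : ℚ) →
    binomialSum e (λ t → if d ℕ.+ t ≡ᵇ c then v else 0ℚ) ≡ binomShift (+ e) c d * v
  binomialSum-indicator zero d c v =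
    trans (cong (λ k → if k ≡ᵇ c then v else 0ℚ) (ℕP.+-identityʳ d)) (indicator≡binomShift d c v)
  binomialSum-indicator (suc e) d c v = begin
    binomialSum e (λ t → if d ℕ.+ t ≡ᵇ c then v else 0ℚ) + binomialSum e (λ t → if d ℕ.+ suc t ≡ᵇ c then v else 0ℚ)
      ≡⟨ cong (λ q → binomialSum e _ + q) (binomialSum-cong e (λ t _ → cong (λ k → if k ≡ᵇ c then v else 0ℚ) (ℕP.+-suc d t))) ⟩
    binomialSum e (λ t → if d ℕ.+ t ≡ᵇ c then v else 0ℚ) + binomialSum e (λ t → if suc d ℕ.+ t ≡ᵇ c then v else 0ℚ)
      ≡⟨ cong₂ _+_ (binomialSum-indicator e d c v) (binomialSum-indicator e (suc d) c v) ⟩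
    binomShift (+ e) c d * v + binomShift (+ e) c (suc d) * v
      ≡⟨ sym (ℚP.*-distribʳ-+ v (binomShift (+ e) c d) (binomShift (+ e) c (suc d))) ⟩
    (binomShift (+ e) c d + binomShift (+ e) c (suc d)) * v
      ≡⟨ cong (_* v) (sym (binomShift-pascal (+ e) c d)) ⟩
    binomShift (+ e ℤ.+ 1ℤ) c d * v
      ≡⟨ cong (λ y → binomShift y c d * v) (sym (+suc≡+1 e)) ⟩
    binomShift (+ suc e) c d * v ∎

module Multinomial where
  open import Data.Nat using (_+_; _*_; NonZero)
  open import Data.Nat.Combinatorics using (_C_; k![n∸k]!∣n!)
  open import Data.Nat.DivMod using (m/n*n≡m)
  open import Data.Nat.Tactic.RingSolver using (solve-∀)
  open ≡-Reasoning

  C*factorials : ∀ p q → ((p + q) C p) * (p ! * q !) ≡ (p + q) !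
  C*factorials p q = begin
    ((p + q) C p) * (p ! * q !)             ≡⟨ cong (λ r → ((p + q) C p) * (p ! * r !)) (sym (ℕP.m+n∸m≡n p q)) ⟩
    ((p + q) C p) * (p ! * (p + q ∸ p) !)   ≡⟨ cong (_* (p ! * (p + q ∸ p) !)) (CSpec.nCk≡n!/k![n-k]! p≤p+q) ⟩
    _                                     ≡⟨ m/n*n≡m {{ℕP._!*_!≢0 p (p + q ∸ p)}} (k![n∸k]!∣n! p≤p+q) ⟩
    (p + q) !                             ∎
    where p≤p+q = ℕP.m≤m+n p q

  C-pos : ∀ p q → 0 < (p + q) C p
  C-pos p q = ℕP.n≢0⇒n>0 λ C≡0 → ℕ.≢-nonZero⁻¹ ((p + q) !) {{ℕP._!≢0 (p + q)}}
    (trans (sym (C*factorials p q)) (cong (_* (p ! * q !)) C≡0))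

  trinomial : ∀ s u v x →
    ((s + u) C s) * ((v + x) C v) * ((s + u + (v + x)) C (s + u)) * (s ! * u ! * v ! * x !) ≡ (s + u + (v + x)) !
  trinomial s u v x = begin
    ((s + u) C s) * ((v + x) C v) * (N C (s + u)) * (s ! * u ! * v ! * x !)
      ≡⟨ regroup ((s + u) C s) ((v + x) C v) (N C (s + u)) (s !) (u !) (v !) (x !) ⟩
    (N C (s + u)) * ((((s + u) C s) * (s ! * u !)) * (((v + x) C v) * (v ! * x !)))
      ≡⟨ cong ((N C (s + u)) *_) (cong₂ _*_ (C*factorials s u) (C*factorials v x)) ⟩
    (N C (s + u)) * ((s + u) ! * (v + x) !)
      ≡⟨ C*factorials (s + u) (v + x) ⟩
    N !   ∎
    where
    N = s + u + (v + x)
    regroup : ∀ a b c s u v x → a * b * c * (s * u * v * x) ≡ c * ((a * (s * u)) * (b * (v * x)))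
    regroup = solve-∀

  multinomial-swap : ∀ s u v x →
    ((s + u) C s) * ((v + x) C v) * ((s + u + (v + x)) C (s + u)) ≡ ((s + v) C s) * ((u + x) C u) * ((s + v + (u + x)) C (s + v))
  multinomial-swap s u v x = ℕP.*-cancelʳ-≡ L R (s ! * u ! * v ! * x !) {{factorials≢0}} (begin
    L * (s ! * u ! * v ! * x !)   ≡⟨ trinomial s u v x ⟩
    (s + u + (v + x)) !           ≡⟨ cong _! (shuffle s u v x) ⟩
    (s + v + (u + x)) !           ≡⟨ sym (trinomial s v u x) ⟩
    R * (s ! * v ! * u ! * x !)   ≡⟨ cong (R *_) (swap (s !) (u !) (v !) (x !)) ⟩
    R * (s ! * u ! * v ! * x !)   ∎)
    where
    L = ((s + u) C s) * ((v + x) C v) * ((s + u + (v + x)) C (s + u))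
    R = ((s + v) C s) * ((u + x) C u) * ((s + v + (u + x)) C (s + v))
    shuffle : ∀ s u v x → s + u + (v + x) ≡ s + v + (u + x)
    shuffle = solve-∀
    swap : ∀ s u v x → s * v * u * x ≡ s * u * v * x
    swap = solve-∀
    factorials≢0 : NonZero (s ! * u ! * v ! * x !)
    factorials≢0 = ℕP.m*n≢0 _ _ {{ℕP.m*n≢0 _ _ {{ℕP._!*_!≢0 s u}} {{ℕP._!≢0 v}}}} {{ℕP._!≢0 x}}

module Kernel where
  open Rationals
  open import Data.Nat.Combinatorics using (_C_)
  open GeneralisedBinomial
  open BinomialSums
  open Multinomial
  open import Data.Nat using (_+_)
  open import Data.Rational using (_*_)
  open ≡-Reasoning

  Mstar-entry : (N r c i : ℕ) → ℚ
  Mstar-entry N r c i =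
    (sgn (r ∸ i) * binom (+ c ℤ.- + i ℤ.- + 1) (r ∸ i))
    ÷' (binom (+ (N ∸ r)) (c ∸ r) * binom (+ (N ∸ c)) (r ∸ i))

  Mstar-value : (t b y : ℕ) → ℚ
  Mstar-value t b y = binom (ℤ.- + b) t ÷' (binom (+ (b + y)) b * binom (+ y) t)

  -- Upper negation, (−1)ᵗ C(b+t−1, t) = C(−b, t), absorbs the sign.
  Mstar-entry-normal : ∀ {N r c} i t b y → r ≡ i + t → c ≡ r + b → N ≡ c + y →
    Mstar-entry N r c i ≡ Mstar-value t b y
  Mstar-entry-normal i t b y refl refl refl = begin
    (sgn (i + t ∸ i) * binom (+ (i + t + b) ℤ.- + i ℤ.- + 1) (i + t ∸ i))
      ÷' (binom (+ (i + t + b + y ∸ (i + t))) (i + t + b ∸ (i + t)) * binom (+ (i + t + b + y ∸ (i + t + b))) (i + t ∸ i))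
      ≡⟨ cong₂ _÷'_ (cong₂ _*_ (cong sgn t≡) (cong₂ binom z≡ t≡))
                    (cong₂ _*_ (cong₂ binom (cong +_ b+y≡) b≡) (cong₂ binom (cong +_ y≡) t≡)) ⟩
    (sgn t * binom (+ b ℤ.+ + t ℤ.- 1ℤ) t) ÷' (binom (+ (b + y)) b * binom (+ y) t)
      ≡⟨ cong (_÷' (binom (+ (b + y)) b * binom (+ y) t)) (sym (binom-neg (+ b) t)) ⟩
    Mstar-value t b y ∎
    where
    t≡ = ℕP.m+n∸m≡n i t
    b≡ = ℕP.m+n∸m≡n (i + t) b
    y≡ = ℕP.m+n∸m≡n (i + t + b) y
    b+y≡ : i + t + b + y ∸ (i + t) ≡ b + y
    b+y≡ = trans (cong (_∸ (i + t)) (ℕP.+-assoc (i + t) b y)) (ℕP.m+n∸m≡n (i + t) (b + y))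
    z≡ : + (i + t + b) ℤ.- + i ℤ.- + 1 ≡ + b ℤ.+ + t ℤ.- 1ℤ
    z≡ = trans (cong (λ k → k ℤ.- + i ℤ.- + 1) (trans (ℤP.pos-+ (i + t) b) (cong (ℤ._+ + b) (ℤP.pos-+ i t))))
               (cancel (+ i) (+ t) (+ b))
      where
      cancel : ∀ (i t b : ℤ) → i ℤ.+ t ℤ.+ b ℤ.- i ℤ.- 1ℤ ≡ b ℤ.+ t ℤ.- 1ℤ
      cancel = ℤ-Solver.solve-∀

  -- With N = m + e, the trinomial revision C(m,s) C(v+x,v) C(N,m) = C(b,s) C(u+x,u) C(N,b)
  -- trades the weight C(m,s) for C(b,s).
  kernel-term : ∀ α {m b e} s u v x → m ≡ s + u → b ≡ s + v → e ≡ v + x →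
    ℕ→ℚ (m C s) * (binomShift (+ e) b s * Mstar-entry (α + m + m + e) (α + m) (α + m + b) (α + s))
      ≡ ℕ→ℚ (b C s) * (inv (ℕ→ℚ ((m + e) C m)) * binomShift (ℤ.- + b) m s)
  kernel-term α s u v x refl refl refl = begin
    p₁ * (binomShift (+ (v + x)) (s + v) s * Mstar-entry (α + (s + u) + (s + u) + (v + x)) (α + (s + u)) (α + (s + u) + (s + v)) (α + s))
      ≡⟨ cong₂ (λ a w → p₁ * (a * w)) upper-shift entry ⟩
    p₁ * (p₂ * (X * inv D))
      ≡⟨ regroup p₁ p₂ X (inv D) ⟩
    p₁ * p₂ * inv D * X
      ≡⟨ cong (λ w → w * inv D * X) (sym (ℕ→ℚ-* ((s + u) C s) ((v + x) C v))) ⟩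
    ℕ→ℚ (((s + u) C s) ℕ.* ((v + x) C v)) * inv D * X
      ≡⟨ cong (_* X) (p*a≡q*d⇒p*inv[d]≡q*inv[a] {ℕ→ℚ (((s + u) C s) ℕ.* ((v + x) C v))} {q₁} {A} {D} A≢0 D≢0 cross) ⟩
    q₁ * inv A * X
      ≡⟨ ℚP.*-assoc q₁ (inv A) X ⟩
    q₁ * (inv A * X)
      ≡⟨ cong (λ w → q₁ * (inv A * w)) (sym lower-shift) ⟩
    q₁ * (inv A * binomShift (ℤ.- + (s + v)) (s + u) s) ∎
    where
    open import Tactic.RingSolver using (solve-∀)
    p₁ = ℕ→ℚ ((s + u) C s)
    p₂ = ℕ→ℚ ((v + x) C v)
    q₁ = ℕ→ℚ ((s + v) C s)
    A′ = (s + u + (v + x)) C (s + u)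
    D′ = ((s + v + (u + x)) C (s + v)) ℕ.* ((u + x) C u)
    A = ℕ→ℚ A′
    D = ℕ→ℚ D′
    X = binom (ℤ.- + (s + v)) u
    regroup : ∀ a b c d → a * (b * (c * d)) ≡ a * b * d * c
    regroup = solve-∀ ℚ-ring
    upper-shift : binomShift (+ (v + x)) (s + v) s ≡ p₂
    upper-shift = trans (binomShift-≤ (+ (v + x)) (ℕP.m≤m+n s v))
                        (trans (cong (binom (+ (v + x))) (ℕP.m+n∸m≡n s v)) (binom-ℕ (v + x) v))
    lower-shift : binomShift (ℤ.- + (s + v)) (s + u) s ≡ X
    lower-shift = trans (binomShift-≤ (ℤ.- + (s + v)) (ℕP.m≤m+n s u)) (cong (binom (ℤ.- + (s + v))) (ℕP.m+n∸m≡n s u))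
    entry : Mstar-entry (α + (s + u) + (s + u) + (v + x)) (α + (s + u)) (α + (s + u) + (s + v)) (α + s) ≡ X * inv D
    entry = begin
      _  ≡⟨ Mstar-entry-normal (α + s) u (s + v) (u + x) (sym (ℕP.+-assoc α s u)) refl (shuffle α s u v x) ⟩
      Mstar-value u (s + v) (u + x)
         ≡⟨ ÷'≡*inv X (binom (+ (s + v + (u + x))) (s + v) * binom (+ (u + x)) u) ⟩
      X * inv (binom (+ (s + v + (u + x))) (s + v) * binom (+ (u + x)) u)
         ≡⟨ cong (λ w → X * inv w) (trans (cong₂ _*_ (binom-ℕ (s + v + (u + x)) (s + v)) (binom-ℕ (u + x) u)) (sym (ℕ→ℚ-* ((s + v + (u + x)) C (s + v)) ((u + x) C u)))) ⟩
      X * inv D ∎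
      where
      shuffle : ∀ α s u v x → α + (s + u) + (s + u) + (v + x) ≡ α + (s + u) + (s + v) + (u + x)
      shuffle = ℕ-Solver.solve-∀
    A≢0 : A ≢ 0ℚ
    A≢0 = ℕ→ℚ-pos⇒≢0 (C-pos (s + u) (v + x))
    D≢0 : D ≢ 0ℚ
    D≢0 = ℕ→ℚ-pos⇒≢0 (ℕP.*-mono-≤ {1} {(s + v + (u + x)) C (s + v)} (C-pos (s + v) (u + x)) (C-pos u x))
    cross : ℕ→ℚ (((s + u) C s) ℕ.* ((v + x) C v)) * A ≡ q₁ * D
    cross = begin
      ℕ→ℚ (((s + u) C s) ℕ.* ((v + x) C v)) * A  ≡⟨ sym (ℕ→ℚ-* (((s + u) C s) ℕ.* ((v + x) C v)) A′) ⟩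
      ℕ→ℚ (((s + u) C s) ℕ.* ((v + x) C v) ℕ.* A′) ≡⟨ cong ℕ→ℚ (trans (multinomial-swap s u v x) (ℕP.*-assoc ((s + v) C s) _ _)) ⟩
      ℕ→ℚ (((s + v) C s) ℕ.* (((u + x) C u) ℕ.* ((s + v + (u + x)) C (s + v)))) ≡⟨ cong (λ w → ℕ→ℚ (((s + v) C s) ℕ.* w)) (ℕP.*-comm ((u + x) C u) _) ⟩
      ℕ→ℚ (((s + v) C s) ℕ.* D′)                 ≡⟨ ℕ→ℚ-* ((s + v) C s) D′ ⟩
      q₁ * D ∎

  kernel : ∀ α m b e {N r c} → r ≡ α + m → c ≡ r + b → N ≡ r + m + e → r + c ≤ N →
    binomialSum m (λ s → binomShift (+ e) b s * Mstar-entry N r c (α + s)) ≡ (if m ≡ᵇ 0 then 1ℚ else 0ℚ)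
  kernel α m b e refl refl refl r+c≤N = begin
    binomialSum m (λ s → binomShift (+ e) b s * Mstar-entry (α + m + m + e) (α + m) (α + m + b) (α + s))
      ≡⟨ binomialSum-reweight m b _ _ term vanishes ⟩
    binomialSum b (λ s → I * binomShift (ℤ.- + b) m s)
      ≡⟨ binomialSum-* b I _ ⟩
    I * binomialSum b (binomShift (ℤ.- + b) m)
      ≡⟨ cong (I *_) (vandermonde b (ℤ.- + b) m) ⟩
    I * binom (ℤ.- + b ℤ.+ + b) m
      ≡⟨ cong (λ z → I * binom z m) (ℤP.+-inverseˡ (+ b)) ⟩
    I * binom (+ 0) m
      ≡⟨ inv*binom0≡kronecker m ⟩
    (if m ≡ᵇ 0 then 1ℚ else 0ℚ) ∎
    where
    I = inv (ℕ→ℚ ((m + e) C m))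
    b≤e : b ≤ e
    b≤e = ℕP.≤-trans (ℕP.m≤n+m b α) (ℕP.+-cancelˡ-≤ (α + m + m) (α + b) e
            (subst (_≤ α + m + m + e) (regroup α m b) r+c≤N))
      where
      regroup : ∀ α m b → α + m + (α + m + b) ≡ α + m + m + (α + b)
      regroup = ℕ-Solver.solve-∀
    term : ∀ s → s ≤ m →
      ℕ→ℚ (m C s) * (binomShift (+ e) b s * Mstar-entry (α + m + m + e) (α + m) (α + m + b) (α + s))
        ≡ ℕ→ℚ (b C s) * (I * binomShift (ℤ.- + b) m s)
    term s s≤m = by-cases (s ℕP.≤? b)
      where
      E = Mstar-entry (α + m + m + e) (α + m) (α + m + b) (α + s)
      by-cases : Dec (s ≤ b) →
        ℕ→ℚ (m C s) * (binomShift (+ e) b s * E) ≡ ℕ→ℚ (b C s) * (I * binomShift (ℤ.- + b) m s)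
      by-cases (yes s≤b) = kernel-term α s (m ∸ s) (b ∸ s) (e ∸ (b ∸ s))
        (sym (ℕP.m+[n∸m]≡n s≤m)) (sym (ℕP.m+[n∸m]≡n s≤b)) (sym (ℕP.m+[n∸m]≡n (ℕP.≤-trans (ℕP.m∸n≤m b s) b≤e)))
      by-cases (no s≰b) = begin
        ℕ→ℚ (m C s) * (binomShift (+ e) b s * E)   ≡⟨ cong (λ w → ℕ→ℚ (m C s) * (w * E)) (binomShift-> (+ e) (ℕP.≰⇒> s≰b)) ⟩
        ℕ→ℚ (m C s) * (0ℚ * E)                     ≡⟨ trans (cong (ℕ→ℚ (m C s) *_) (ℚP.*-zeroˡ E)) (ℚP.*-zeroʳ (ℕ→ℚ (m C s))) ⟩
        0ℚ                                         ≡⟨ sym (ℚP.*-zeroˡ (I * binomShift (ℤ.- + b) m s)) ⟩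
        0ℚ * (I * binomShift (ℤ.- + b) m s)        ≡⟨ cong (λ n → ℕ→ℚ n * (I * binomShift (ℤ.- + b) m s)) (sym (CSpec.k>n⇒nCk≡0 (ℕP.≰⇒> s≰b))) ⟩
        ℕ→ℚ (b C s) * (I * binomShift (ℤ.- + b) m s) ∎
    vanishes : ∀ s → m < s → I * binomShift (ℤ.- + b) m s ≡ 0ℚ
    vanishes s m<s = trans (cong (I *_) (binomShift-> (ℤ.- + b) m<s)) (ℚP.*-zeroʳ I)
    inv*binom0≡kronecker : ∀ m → inv (ℕ→ℚ ((m + e) C m)) * binom (+ 0) m ≡ (if m ≡ᵇ 0 then 1ℚ else 0ℚ)
    inv*binom0≡kronecker zero = refl
    inv*binom0≡kronecker (suc m) = trans (cong (inv (ℕ→ℚ ((suc m + e) C suc m)) *_) (binom-0-suc m)) (ℚP.*-zeroʳ (inv (ℕ→ℚ ((suc m + e) C suc m))))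

module SubsetSums where
  open BinomialSums
  open import Data.Nat using (_+_)
  open import Data.List using (List; []; _∷_; map; _++_)
  open import Data.List.Properties using (map-++; map-∘)
  open import Data.Vec using ([]; _∷_)
  open import Data.Fin.Subset using (Subset; ∣_∣; _∩_; ∁)
  open import Data.Fin.Subset.Properties using (∣p∣≤n; ∣∁p∣≡n∸∣p∣; ∩-comm)
  open ≡-Reasoning

  sumℚ-++ : ∀ (xs ys : List ℚ) → sumℚ (xs ++ ys) ≡ sumℚ xs ℚ.+ sumℚ ys
  sumℚ-++ [] ys = sym (ℚP.+-identityˡ _)
  sumℚ-++ (x ∷ xs) ys = trans (cong (x ℚ.+_) (sumℚ-++ xs ys)) (sym (ℚP.+-assoc x _ _))

  sum-subsets-suc : ∀ n (f : Subset (suc n) → ℚ) →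
    sumℚ (map f (subsets (suc n))) ≡ sumℚ (map (λ X → f (false ∷ X)) (subsets n)) ℚ.+ sumℚ (map (λ X → f (true ∷ X)) (subsets n))
  sum-subsets-suc n f = begin
    sumℚ (map f (map (true ∷_) S ++ map (false ∷_) S))
      ≡⟨ cong sumℚ (map-++ f (map (true ∷_) S) (map (false ∷_) S)) ⟩
    sumℚ (map f (map (true ∷_) S) ++ map f (map (false ∷_) S))
      ≡⟨ sumℚ-++ (map f (map (true ∷_) S)) _ ⟩
    sumℚ (map f (map (true ∷_) S)) ℚ.+ sumℚ (map f (map (false ∷_) S))
      ≡⟨ cong₂ ℚ._+_ (cong sumℚ (sym (map-∘ S))) (cong sumℚ (sym (map-∘ S))) ⟩
    sumℚ (map (λ X → f (true ∷ X)) S) ℚ.+ sumℚ (map (λ X → f (false ∷ X)) S)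
      ≡⟨ ℚP.+-comm (sumℚ (map (λ X → f (true ∷ X)) S)) _ ⟩
    sumℚ (map (λ X → f (false ∷ X)) S) ℚ.+ sumℚ (map (λ X → f (true ∷ X)) S) ∎
    where S = subsets n

  sum-∁ : ∀ n (f : Subset n → ℚ) → sumℚ (map f (subsets n)) ≡ sumℚ (map (λ Y → f (∁ Y)) (subsets n))
  sum-∁ zero f = refl
  sum-∁ (suc n) f = begin
    sumℚ (map f (subsets (suc n)))
      ≡⟨ sum-subsets-suc n f ⟩
    sumℚ (map (λ X → f (false ∷ X)) S) ℚ.+ sumℚ (map (λ X → f (true ∷ X)) S)
      ≡⟨ cong₂ ℚ._+_ (sum-∁ n (λ X → f (false ∷ X))) (sum-∁ n (λ X → f (true ∷ X))) ⟩
    sumℚ (map (λ Y → f (false ∷ ∁ Y)) S) ℚ.+ sumℚ (map (λ Y → f (true ∷ ∁ Y)) S)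
      ≡⟨ ℚP.+-comm (sumℚ (map (λ Y → f (false ∷ ∁ Y)) S)) _ ⟩
    sumℚ (map (λ Y → f (true ∷ ∁ Y)) S) ℚ.+ sumℚ (map (λ Y → f (false ∷ ∁ Y)) S)
      ≡⟨ sym (sum-subsets-suc n (λ Y → f (∁ Y))) ⟩
    sumℚ (map (λ Y → f (∁ Y)) (subsets (suc n))) ∎
    where S = subsets n

  ∣p∩q∣+∣p∩∁q∣≡∣p∣ : ∀ {n} (p q : Subset n) → ∣ p ∩ q ∣ + ∣ p ∩ ∁ q ∣ ≡ ∣ p ∣
  ∣p∩q∣+∣p∩∁q∣≡∣p∣ [] [] = refl
  ∣p∩q∣+∣p∩∁q∣≡∣p∣ (true ∷ p) (true ∷ q) = cong suc (∣p∩q∣+∣p∩∁q∣≡∣p∣ p q)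
  ∣p∩q∣+∣p∩∁q∣≡∣p∣ (true ∷ p) (false ∷ q) = trans (ℕP.+-suc _ _) (cong suc (∣p∩q∣+∣p∩∁q∣≡∣p∣ p q))
  ∣p∩q∣+∣p∩∁q∣≡∣p∣ (false ∷ p) (_ ∷ q) = ∣p∩q∣+∣p∩∁q∣≡∣p∣ p q

  ∣p∩q∣+∣∁p∩q∣≡∣q∣ : ∀ {n} (p q : Subset n) → ∣ p ∩ q ∣ + ∣ ∁ p ∩ q ∣ ≡ ∣ q ∣
  ∣p∩q∣+∣∁p∩q∣≡∣q∣ p q =
    trans (cong₂ (λ a b → ∣ a ∣ + ∣ b ∣) (∩-comm p q) (∩-comm (∁ p) q)) (∣p∩q∣+∣p∩∁q∣≡∣p∣ q p)

  ∣p∣+∣∁p∣≡n : ∀ {n} (p : Subset n) → ∣ p ∣ + ∣ ∁ p ∣ ≡ n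
  ∣p∣+∣∁p∣≡n {n} p = trans (cong (λ k → ∣ p ∣ + k) (∣∁p∣≡n∸∣p∣ p)) (ℕP.m+[n∸m]≡n (∣p∣≤n p))

  cells-total : ∀ {n} (p q : Subset n) → ∣ p ∩ q ∣ + ∣ p ∩ ∁ q ∣ + ∣ ∁ p ∩ q ∣ + ∣ ∁ p ∩ ∁ q ∣ ≡ n
  cells-total p q = begin
    ∣ p ∩ q ∣ + ∣ p ∩ ∁ q ∣ + ∣ ∁ p ∩ q ∣ + ∣ ∁ p ∩ ∁ q ∣    ≡⟨ ℕP.+-assoc (∣ p ∩ q ∣ + ∣ p ∩ ∁ q ∣) _ _ ⟩
    ∣ p ∩ q ∣ + ∣ p ∩ ∁ q ∣ + (∣ ∁ p ∩ q ∣ + ∣ ∁ p ∩ ∁ q ∣)  ≡⟨ cong₂ _+_ (∣p∩q∣+∣p∩∁q∣≡∣p∣ p q) (∣p∩q∣+∣p∩∁q∣≡∣p∣ (∁ p) q) ⟩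
    ∣ p ∣ + ∣ ∁ p ∣                                        ≡⟨ ∣p∣+∣∁p∣≡n p ⟩
    _                                                      ∎

  -- With cells of sizes α = ∣ A ∩ B ∣, β = ∣ A ∩ ∁ B ∣, γ = ∣ ∁ A ∩ B ∣, ε = ∣ ∁ A ∩ ∁ B ∣, a subset X
  -- meeting them in p, q, s, t elements has ∣ X ∣ = p + q + s + t, ∣ A ∩ X ∣ = p + q, ∣ B ∩ X ∣ = p + s.
  classSum : (α β γ ε : ℕ) → (ℕ → ℕ → ℕ → ℚ) → ℚ
  classSum α β γ ε G =
    binomialSum α λ p → binomialSum β λ q → binomialSum γ λ s → binomialSum ε λ t →
      G (p + q + s + t) (p + q) (p + s)

  classSum-sucβ : ∀ α β γ ε G →
    classSum α (suc β) γ ε G ≡ classSum α β γ ε G ℚ.+ classSum α β γ ε (λ x y z → G (suc x) (suc y) z)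
  classSum-sucβ α β γ ε G = trans (binomialSum-+ α _ _) (cong (classSum α β γ ε G ℚ.+_)
    (binomialSum-cong α λ p _ → binomialSum-cong β λ q _ → binomialSum-cong γ λ s _ → binomialSum-cong ε λ t _ →
      cong₂ (λ x y → G x y (p + s)) (cong (λ k → k + s + t) (ℕP.+-suc p q)) (ℕP.+-suc p q)))

  classSum-sucγ : ∀ α β γ ε G →
    classSum α β (suc γ) ε G ≡ classSum α β γ ε G ℚ.+ classSum α β γ ε (λ x y z → G (suc x) y (suc z))
  classSum-sucγ α β γ ε G = trans (binomialSum-cong α (λ p _ → binomialSum-+ β _ _)) (trans (binomialSum-+ α _ _)
    (cong (classSum α β γ ε G ℚ.+_)
      (binomialSum-cong α λ p _ → binomialSum-cong β λ q _ → binomialSum-cong γ λ s _ → binomialSum-cong ε λ t _ →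
        cong₂ (λ x z → G x (p + q) z) (cong (_+ t) (ℕP.+-suc (p + q) s)) (ℕP.+-suc p s))))

  classSum-sucε : ∀ α β γ ε G →
    classSum α β γ (suc ε) G ≡ classSum α β γ ε G ℚ.+ classSum α β γ ε (λ x y z → G (suc x) y z)
  classSum-sucε α β γ ε G =
    trans (binomialSum-cong α (λ p _ → trans (binomialSum-cong β (λ q _ → binomialSum-+ γ _ _)) (binomialSum-+ β _ _)))
      (trans (binomialSum-+ α _ _) (cong (classSum α β γ ε G ℚ.+_)
        (binomialSum-cong α λ p _ → binomialSum-cong β λ q _ → binomialSum-cong γ λ s _ → binomialSum-cong ε λ t _ →
          cong (λ x → G x (p + q) (p + s)) (ℕP.+-suc (p + q + s) t))))

  sum-by-cells : ∀ n (A B : Subset n) (G : ℕ → ℕ → ℕ → ℚ) →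
    sumℚ (map (λ X → G ∣ X ∣ (∣ A ∩ X ∣) (∣ B ∩ X ∣)) (subsets n))
      ≡ classSum (∣ A ∩ B ∣) (∣ A ∩ ∁ B ∣) (∣ ∁ A ∩ B ∣) (∣ ∁ A ∩ ∁ B ∣) G
  sum-by-cells zero [] [] G = ℚP.+-identityʳ _
  sum-by-cells (suc n) (true ∷ A) (true ∷ B) G = trans (sum-subsets-suc n _)
    (cong₂ ℚ._+_ (sum-by-cells n A B G) (sum-by-cells n A B (λ x y z → G (suc x) (suc y) (suc z))))
  sum-by-cells (suc n) (true ∷ A) (false ∷ B) G = trans (sum-subsets-suc n _)
    (trans (cong₂ ℚ._+_ (sum-by-cells n A B G) (sum-by-cells n A B (λ x y z → G (suc x) (suc y) z)))
           (sym (classSum-sucβ (∣ A ∩ B ∣) (∣ A ∩ ∁ B ∣) (∣ ∁ A ∩ B ∣) (∣ ∁ A ∩ ∁ B ∣) G)))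
  sum-by-cells (suc n) (false ∷ A) (true ∷ B) G = trans (sum-subsets-suc n _)
    (trans (cong₂ ℚ._+_ (sum-by-cells n A B G) (sum-by-cells n A B (λ x y z → G (suc x) y (suc z))))
           (sym (classSum-sucγ (∣ A ∩ B ∣) (∣ A ∩ ∁ B ∣) (∣ ∁ A ∩ B ∣) (∣ ∁ A ∩ ∁ B ∣) G)))
  sum-by-cells (suc n) (false ∷ A) (false ∷ B) G = trans (sum-subsets-suc n _)
    (trans (cong₂ ℚ._+_ (sum-by-cells n A B G) (sum-by-cells n A B (λ x y z → G (suc x) y z)))
           (sym (classSum-sucε (∣ A ∩ B ∣) (∣ A ∩ ∁ B ∣) (∣ ∁ A ∩ B ∣) (∣ ∁ A ∩ ∁ B ∣) G)))

  classSum-collapse : ∀ α β γ ε G → (∀ x y z → y ≢ α + β → G x y z ≡ 0ℚ) →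
    classSum α β γ ε G ≡ binomialSum γ (λ s → binomialSum ε (λ t → G (α + β + s + t) (α + β) (α + s)))
  classSum-collapse α β γ ε G G-vanishes =
    trans (binomialSum-top α _ λ p p<α → binomialSum-zero β _ λ q q≤β →
             inner p q (ℕP.<⇒≢ (ℕP.+-mono-<-≤ p<α q≤β)))
          (binomialSum-top β _ λ q q<β → inner α q (ℕP.<⇒≢ (ℕP.+-monoʳ-< α q<β)))
    where
    inner : ∀ p q → p + q ≢ α + β →
      binomialSum γ (λ s → binomialSum ε (λ t → G (p + q + s + t) (p + q) (p + s))) ≡ 0ℚ
    inner p q p+q≢α+β = binomialSum-zero γ _ λ s _ → binomialSum-zero ε _ λ t _ → G-vanishes _ _ _ p+q≢α+β

module Matrices where
  open Kernel using (Mstar-entry)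
  open import Data.Vec using ([]; _∷_; here)
  open import Data.Vec.Properties using (≡-dec)
  open import Data.Bool.Properties using (not-involutive) renaming (_≟_ to _≟ᴮ_)
  open import Data.Fin.Subset using (Subset; ∣_∣; _∩_; _⊆_; ∁; ⊥)
  open import Data.Fin.Subset.Properties using (_⊆?_; out⊆; in⊆in; drop-∷-⊆; ∣p∩q∣≤∣p∣; ∩-inverseˡ; ∣⊥∣≡0; p⊆q⇒∁p⊇∁q)

  p⊆q⇒∣p∩q∣≡∣p∣ : ∀ {n} (p q : Subset n) → p ⊆ q → ∣ p ∩ q ∣ ≡ ∣ p ∣
  p⊆q⇒∣p∩q∣≡∣p∣ [] [] _ = refl
  p⊆q⇒∣p∩q∣≡∣p∣ (true ∷ p) (true ∷ q) p⊆q = cong suc (p⊆q⇒∣p∩q∣≡∣p∣ p q (drop-∷-⊆ p⊆q))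
  p⊆q⇒∣p∩q∣≡∣p∣ (true ∷ p) (false ∷ q) p⊆q with p⊆q here
  ... | ()
  p⊆q⇒∣p∩q∣≡∣p∣ (false ∷ p) (_ ∷ q) p⊆q = p⊆q⇒∣p∩q∣≡∣p∣ p q (drop-∷-⊆ p⊆q)

  ∣p∩q∣≡∣p∣⇒p⊆q : ∀ {n} (p q : Subset n) → ∣ p ∩ q ∣ ≡ ∣ p ∣ → p ⊆ q
  ∣p∩q∣≡∣p∣⇒p⊆q [] [] _ ()
  ∣p∩q∣≡∣p∣⇒p⊆q (true ∷ p) (true ∷ q) eq = in⊆in (∣p∩q∣≡∣p∣⇒p⊆q p q (ℕP.suc-injective eq))
  ∣p∩q∣≡∣p∣⇒p⊆q (true ∷ p) (false ∷ q) eq = ⊥-elim (ℕP.<⇒≢ (s≤s (∣p∩q∣≤∣p∣ p q)) eq)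
  ∣p∩q∣≡∣p∣⇒p⊆q (false ∷ p) (_ ∷ q) eq = out⊆ (∣p∩q∣≡∣p∣⇒p⊆q p q eq)

  M≡indicator : ∀ n r c (R X : Subset n) → M n r c R X ≡ (if ∣ R ∩ X ∣ ≡ᵇ ∣ R ∣ then 1ℚ else 0ℚ)
  M≡indicator n r c R X with R ⊆? X
  ... | yes R⊆X = sym (cong (if_then 1ℚ else 0ℚ) (dec-true (_ ℕP.≟ _) (p⊆q⇒∣p∩q∣≡∣p∣ R X R⊆X)))
  ... | no R⊈X = sym (cong (if_then 1ℚ else 0ℚ) (dec-false (_ ℕP.≟ _) (λ eq → R⊈X (∣p∩q∣≡∣p∣⇒p⊆q R X eq))))

  Mstar≡Mstar-entry : ∀ n r c (X R : Subset n) → Mstar n r c X R ≡ Mstar-entry (bigN n r c) r c ∣ R ∩ X ∣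
  Mstar≡Mstar-entry n r c X R = refl

  δ-refl : ∀ {n} (X : Subset n) → δ X X ≡ 1ℚ
  δ-refl X with ≡-dec _≟ᴮ_ X X
  ... | yes _ = refl
  ... | no X≢X = ⊥-elim (X≢X refl)

  δ-≢ : ∀ {n} {X Y : Subset n} → X ≢ Y → δ X Y ≡ 0ℚ
  δ-≢ {X = X} {Y} X≢Y with ≡-dec _≟ᴮ_ X Y
  ... | yes X≡Y = ⊥-elim (X≢Y X≡Y)
  ... | no _ = refl

  ∣p∩∁q∣≡0⇒∣∁p∩q∣≡0⇒p≡q : ∀ {n} (p q : Subset n) → ∣ p ∩ ∁ q ∣ ≡ 0 → ∣ ∁ p ∩ q ∣ ≡ 0 → p ≡ q
  ∣p∩∁q∣≡0⇒∣∁p∩q∣≡0⇒p≡q [] [] _ _ = refl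
  ∣p∩∁q∣≡0⇒∣∁p∩q∣≡0⇒p≡q (true ∷ p) (true ∷ q) p∖q q∖p = cong (true ∷_) (∣p∩∁q∣≡0⇒∣∁p∩q∣≡0⇒p≡q p q p∖q q∖p)
  ∣p∩∁q∣≡0⇒∣∁p∩q∣≡0⇒p≡q (false ∷ p) (false ∷ q) p∖q q∖p = cong (false ∷_) (∣p∩∁q∣≡0⇒∣∁p∩q∣≡0⇒p≡q p q p∖q q∖p)

  kronecker≡δ : ∀ {n} (R R′ : Subset n) → ∣ R ∩ ∁ R′ ∣ ≡ ∣ ∁ R ∩ R′ ∣ →
    (if ∣ ∁ R ∩ R′ ∣ ≡ᵇ 0 then 1ℚ else 0ℚ) ≡ δ R R′
  kronecker≡δ {n} R R′ β≡γ = by-size (∣ ∁ R ∩ R′ ∣) refl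
    where
    by-size : ∀ k → ∣ ∁ R ∩ R′ ∣ ≡ k → (if k ≡ᵇ 0 then 1ℚ else 0ℚ) ≡ δ R R′
    by-size zero γ≡0 = sym (subst (λ Y → δ R Y ≡ 1ℚ) (∣p∩∁q∣≡0⇒∣∁p∩q∣≡0⇒p≡q R R′ (trans β≡γ γ≡0) γ≡0) (δ-refl R))
    by-size (suc k) γ≡k+1 = sym (δ-≢ λ R≡R′ → ℕP.0≢1+n (begin
      0                 ≡⟨ sym (∣⊥∣≡0 n) ⟩
      ∣ ⊥ {n} ∣         ≡⟨ cong ∣_∣ (sym (∩-inverseˡ R)) ⟩
      ∣ ∁ R ∩ R ∣       ≡⟨ cong (λ Y → ∣ ∁ R ∩ Y ∣) R≡R′ ⟩
      ∣ ∁ R ∩ R′ ∣      ≡⟨ γ≡k+1 ⟩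
      suc k             ∎))
      where open ≡-Reasoning

  ∁-involutive : ∀ {n} (p : Subset n) → ∁ (∁ p) ≡ p
  ∁-involutive [] = refl
  ∁-involutive (x ∷ p) = cong₂ _∷_ (not-involutive x) (∁-involutive p)

  ∁p⊆q⇒∁q⊆p : ∀ {n} {p q : Subset n} → ∁ p ⊆ q → ∁ q ⊆ p
  ∁p⊆q⇒∁q⊆p {p = p} ∁p⊆q = subst (λ r → ∁ _ ⊆ r) (∁-involutive p) (p⊆q⇒∁p⊇∁q ∁p⊆q)

  M-∁ : ∀ {n} r c r′ c′ (X Y : Subset n) → M n r c (∁ X) Y ≡ M n r′ c′ (∁ Y) X
  M-∁ r c r′ c′ X Y with ∁ X ⊆? Y | ∁ Y ⊆? X
  ... | yes _ | yes _ = refl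
  ... | no _ | no _ = refl
  ... | yes ∁X⊆Y | no ∁Y⊈X = ⊥-elim (∁Y⊈X (∁p⊆q⇒∁q⊆p ∁X⊆Y))
  ... | no ∁X⊈Y | yes ∁Y⊆X = ⊥-elim (∁X⊈Y (∁p⊆q⇒∁q⊆p ∁Y⊆X))

  δ-∁ : ∀ {n} (X Y : Subset n) → δ (∁ Y) (∁ X) ≡ δ X Y
  δ-∁ X Y = by-cases (≡-dec _≟ᴮ_ X Y)
    where
    open ≡-Reasoning
    by-cases : Dec (X ≡ Y) → δ (∁ Y) (∁ X) ≡ δ X Y
    by-cases (yes refl) = trans (δ-refl (∁ X)) (sym (δ-refl X))
    by-cases (no X≢Y) = trans (δ-≢ (λ ∁Y≡∁X → X≢Y (begin
      X          ≡⟨ sym (∁-involutive X) ⟩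
      ∁ (∁ X)    ≡⟨ cong ∁ (sym ∁Y≡∁X) ⟩
      ∁ (∁ Y)    ≡⟨ ∁-involutive Y ⟩
      Y          ∎))) (sym (δ-≢ X≢Y))

module Inverses where
  open BinomialSums
  open Kernel
  open SubsetSums
  open Matrices
  open import Data.Nat using (_+_)
  open import Data.Rational using (_*_)
  open import Data.List using (map)
  open import Data.List.Properties using (map-cong)
  open import Data.Fin.Subset using (Subset; ∣_∣; _∩_; ∁)
  open import Data.Fin.Subset.Properties using (∣∁p∣≡n∸∣p∣; ∩-comm)
  open ≡-Reasoning

  indicator-* : ∀ b (q : ℚ) → (if b then 1ℚ else 0ℚ) * q ≡ (if b then q else 0ℚ)
  indicator-* true q = ℚP.*-identityˡ q
  indicator-* false q = ℚP.*-zeroˡ q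

  MMstar≡δ : ∀ r c n → r ≤ c → r + c ≤ n → (R R′ : Subset n) → ∣ R ∣ ≡ r → ∣ R′ ∣ ≡ r →
    sumOver n c (λ C → M n r c R C * Mstar n r c C R′) ≡ δ R R′
  MMstar≡δ r c n r≤c r+c≤n R R′ ∣R∣≡r ∣R′∣≡r = begin
    sumOver n c (λ C → M n r c R C * Mstar n r c C R′)
      ≡⟨ cong sumℚ (map-cong summand (subsets n)) ⟩
    sumℚ (map (λ X → G ∣ X ∣ (∣ R ∩ X ∣) (∣ R′ ∩ X ∣)) (subsets n))
      ≡⟨ sum-by-cells n R R′ G ⟩
    classSum α β γ ε G
      ≡⟨ classSum-collapse α β γ ε G G-vanishes ⟩
    binomialSum γ (λ s → binomialSum ε (λ t → G (α + β + s + t) (α + β) (α + s)))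
      ≡⟨ binomialSum-cong γ (λ s _ → inner s) ⟩
    binomialSum γ (λ s → binomShift (+ ε) b s * F (α + s))
      ≡⟨ kernel α γ b ε (sym α+γ≡r) (sym (ℕP.m+[n∸m]≡n r≤c)) N≡r+γ+ε (subst (r + c ≤_) (sym N≡n) r+c≤n) ⟩
    (if γ ≡ᵇ 0 then 1ℚ else 0ℚ)
      ≡⟨ kronecker≡δ R R′ β≡γ ⟩
    δ R R′ ∎
    where
    N = bigN n r c
    F = Mstar-entry N r c
    G : ℕ → ℕ → ℕ → ℚ
    G x y z = if x ≡ᵇ c then (if y ≡ᵇ r then F z else 0ℚ) else 0ℚ
    α = ∣ R ∩ R′ ∣
    β = ∣ R ∩ ∁ R′ ∣
    γ = ∣ ∁ R ∩ R′ ∣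
    ε = ∣ ∁ R ∩ ∁ R′ ∣
    b = c ∸ r
    α+β≡r : α + β ≡ r
    α+β≡r = trans (∣p∩q∣+∣p∩∁q∣≡∣p∣ R R′) ∣R∣≡r
    α+γ≡r : α + γ ≡ r
    α+γ≡r = trans (∣p∩q∣+∣∁p∩q∣≡∣q∣ R R′) ∣R′∣≡r
    β≡γ : β ≡ γ
    β≡γ = ℕP.+-cancelˡ-≡ α β γ (trans α+β≡r (sym α+γ≡r))
    N≡n : N ≡ n
    N≡n = ℕP.m≥n⇒m⊔n≡m r+c≤n
    N≡r+γ+ε : N ≡ r + γ + ε
    N≡r+γ+ε = trans N≡n (trans (sym (cells-total R R′)) (cong (λ k → k + γ + ε) α+β≡r))
    summand : ∀ X → (if ∣ X ∣ ≡ᵇ c then M n r c R X * Mstar n r c X R′ else 0ℚ) ≡ G ∣ X ∣ (∣ R ∩ X ∣) (∣ R′ ∩ X ∣)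
    summand X = cong (λ v → if ∣ X ∣ ≡ᵇ c then v else 0ℚ)
      (trans (cong (_* F ∣ R′ ∩ X ∣) (trans (M≡indicator n r c R X) (cong (λ k → if ∣ R ∩ X ∣ ≡ᵇ k then 1ℚ else 0ℚ) ∣R∣≡r)))
             (indicator-* (∣ R ∩ X ∣ ≡ᵇ r) (F ∣ R′ ∩ X ∣)))
    G-vanishes : ∀ x y z → y ≢ α + β → G x y z ≡ 0ℚ
    G-vanishes x y z y≢α+β =
      trans (cong (λ w → if x ≡ᵇ c then (if w then F z else 0ℚ) else 0ℚ)
                  (dec-false (y ℕP.≟ r) (λ y≡r → y≢α+β (trans y≡r (sym α+β≡r)))))
            (if-0-0 (x ≡ᵇ c))
      where
      if-0-0 : ∀ b → (if b then 0ℚ else 0ℚ) ≡ 0ℚ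
      if-0-0 true = refl
      if-0-0 false = refl
    inner : ∀ s → binomialSum ε (λ t → G (α + β + s + t) (α + β) (α + s)) ≡ binomShift (+ ε) b s * F (α + s)
    inner s = begin
      binomialSum ε (λ t → G (α + β + s + t) (α + β) (α + s))
        ≡⟨ binomialSum-cong ε (λ t _ → cong (λ w → if α + β + s + t ≡ᵇ c then (if w then F (α + s) else 0ℚ) else 0ℚ)
                                            (dec-true (α + β ℕP.≟ r) α+β≡r)) ⟩
      binomialSum ε (λ t → if α + β + s + t ≡ᵇ c then F (α + s) else 0ℚ)
        ≡⟨ binomialSum-indicator ε (α + β + s) c (F (α + s)) ⟩
      binomShift (+ ε) c (α + β + s) * F (α + s)
        ≡⟨ cong (λ k → binomShift (+ ε) k (α + β + s) * F (α + s)) c≡α+β+b ⟩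
      binomShift (+ ε) (α + β + b) (α + β + s) * F (α + s)
        ≡⟨ cong (_* F (α + s)) (binomShift-+ (+ ε) (α + β) b s) ⟩
      binomShift (+ ε) b s * F (α + s) ∎
      where
      c≡α+β+b : c ≡ α + β + b
      c≡α+β+b = trans (sym (ℕP.m+[n∸m]≡n r≤c)) (cong (_+ b) (sym α+β≡r))

  [n∸c]+[n∸r]≤n : ∀ {r c n} → c ≤ n → n ≤ r + c → n ∸ c + (n ∸ r) ≤ n
  [n∸c]+[n∸r]≤n {r} {c} {n} c≤n n≤r+c =
    ℕP.≤-trans (ℕP.+-monoʳ-≤ (n ∸ c) (ℕP.m≤n+o⇒m∸n≤o n r n≤r+c)) (ℕP.≤-reflexive (ℕP.m∸n+n≡m c≤n))

  Mstar-complement : ∀ r c n → r ≤ c → c ≤ n → n ≤ r + c → (X Y : Subset n) → ∣ X ∣ ≡ c → ∣ Y ∣ ≡ n ∸ r →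
    Mstar n r c X (∁ Y) ≡ Mstar n (n ∸ c) (n ∸ r) Y (∁ X)
  Mstar-complement r c n r≤c c≤n n≤r+c X Y ∣X∣≡c ∣Y∣≡n∸r = begin
    Mstar n r c X (∁ Y)
      ≡⟨ Mstar≡Mstar-entry n r c X (∁ Y) ⟩
    Mstar-entry (bigN n r c) r c (∣ ∁ Y ∩ X ∣)
      ≡⟨ Mstar-entry-normal (∣ ∁ Y ∩ X ∣) ε b r r≡i+ε c≡r+b
           (trans (ℕP.m≤n⇒m⊔n≡n n≤r+c) (ℕP.+-comm r c)) ⟩
    Mstar-value ε b r
      ≡⟨ sym (Mstar-entry-normal (∣ ∁ X ∩ Y ∣) ε b r r′≡i′+ε c′≡r′+b
           (trans (ℕP.m≥n⇒m⊔n≡m r′+c′≤n) (sym (ℕP.m∸n+n≡m r≤n)))) ⟩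
    Mstar-entry (bigN n r′ c′) r′ c′ (∣ ∁ X ∩ Y ∣)
      ≡⟨ sym (Mstar≡Mstar-entry n r′ c′ Y (∁ X)) ⟩
    Mstar n r′ c′ Y (∁ X) ∎
    where
    r′ = n ∸ c
    c′ = n ∸ r
    b = c ∸ r
    ε = ∣ ∁ Y ∩ ∁ X ∣
    r≤n = ℕP.≤-trans r≤c c≤n
    r≡i+ε : r ≡ ∣ ∁ Y ∩ X ∣ + ε
    r≡i+ε = begin
      r                 ≡⟨ sym (ℕP.m∸[m∸n]≡n r≤n) ⟩
      n ∸ (n ∸ r)       ≡⟨ cong (n ∸_) (sym ∣Y∣≡n∸r) ⟩
      n ∸ ∣ Y ∣         ≡⟨ sym (∣∁p∣≡n∸∣p∣ Y) ⟩
      ∣ ∁ Y ∣           ≡⟨ sym (∣p∩q∣+∣p∩∁q∣≡∣p∣ (∁ Y) X) ⟩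
      ∣ ∁ Y ∩ X ∣ + ε   ∎
    r′≡i′+ε : r′ ≡ ∣ ∁ X ∩ Y ∣ + ε
    r′≡i′+ε = begin
      n ∸ c                            ≡⟨ cong (n ∸_) (sym ∣X∣≡c) ⟩
      n ∸ ∣ X ∣                        ≡⟨ sym (∣∁p∣≡n∸∣p∣ X) ⟩
      ∣ ∁ X ∣                          ≡⟨ sym (∣p∩q∣+∣p∩∁q∣≡∣p∣ (∁ X) Y) ⟩
      ∣ ∁ X ∩ Y ∣ + ∣ ∁ X ∩ ∁ Y ∣      ≡⟨ cong (λ Z → ∣ ∁ X ∩ Y ∣ + ∣ Z ∣) (∩-comm (∁ X) (∁ Y)) ⟩
      ∣ ∁ X ∩ Y ∣ + ε                  ∎
    c≡r+b : c ≡ r + b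
    c≡r+b = sym (ℕP.m+[n∸m]≡n r≤c)
    c′≡r′+b : c′ ≡ r′ + b
    c′≡r′+b = trans (cong (_∸ r) (sym (ℕP.m∸n+n≡m c≤n))) (ℕP.+-∸-assoc (n ∸ c) r≤c)
    r′+c′≤n : r′ + c′ ≤ n
    r′+c′≤n = [n∸c]+[n∸r]≤n c≤n n≤r+c

  MstarM≡δ : ∀ r c n → r ≤ c → c ≤ n → n ≤ r + c → (C C′ : Subset n) → ∣ C ∣ ≡ c → ∣ C′ ∣ ≡ c →
    sumOver n r (λ R → Mstar n r c C R * M n r c R C′) ≡ δ C C′
  MstarM≡δ r c n r≤c c≤n n≤r+c C C′ ∣C∣≡c ∣C′∣≡c = begin
    sumℚ (map f (subsets n))
      ≡⟨ sum-∁ n f ⟩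
    sumℚ (map (λ Y → f (∁ Y)) (subsets n))
      ≡⟨ cong sumℚ (map-cong summand (subsets n)) ⟩
    sumOver n c′ (λ Y → M n r′ c′ (∁ C′) Y * Mstar n r′ c′ Y (∁ C))
      ≡⟨ MMstar≡δ r′ c′ n (ℕP.∸-monoʳ-≤ n r≤c) r′+c′≤n (∁ C′) (∁ C) (∣∁X∣≡r′ C′ ∣C′∣≡c) (∣∁X∣≡r′ C ∣C∣≡c) ⟩
    δ (∁ C′) (∁ C)
      ≡⟨ δ-∁ C C′ ⟩
    δ C C′ ∎
    where
    r′ = n ∸ c
    c′ = n ∸ r
    r≤n = ℕP.≤-trans r≤c c≤n
    f : Subset n → ℚ
    f R = if ∣ R ∣ ≡ᵇ r then Mstar n r c C R * M n r c R C′ else 0ℚ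
    r′+c′≤n : r′ + c′ ≤ n
    r′+c′≤n = [n∸c]+[n∸r]≤n c≤n n≤r+c
    ∣∁X∣≡r′ : ∀ X → ∣ X ∣ ≡ c → ∣ ∁ X ∣ ≡ r′
    ∣∁X∣≡r′ X ∣X∣≡c = trans (∣∁p∣≡n∸∣p∣ X) (cong (n ∸_) ∣X∣≡c)
    summand : ∀ Y → f (∁ Y) ≡ (if ∣ Y ∣ ≡ᵇ c′ then M n r′ c′ (∁ C′) Y * Mstar n r′ c′ Y (∁ C) else 0ℚ)
    summand Y = by-cases (∣ Y ∣ ℕP.≟ c′)
      where
      by-cases : Dec (∣ Y ∣ ≡ c′) → f (∁ Y) ≡ (if ∣ Y ∣ ≡ᵇ c′ then M n r′ c′ (∁ C′) Y * Mstar n r′ c′ Y (∁ C) else 0ℚ)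
      by-cases (yes ∣Y∣≡c′) = begin
        f (∁ Y)
          ≡⟨ cong (if_then Mstar n r c C (∁ Y) * M n r c (∁ Y) C′ else 0ℚ) (dec-true (∣ ∁ Y ∣ ℕP.≟ r) ∣∁Y∣≡r) ⟩
        Mstar n r c C (∁ Y) * M n r c (∁ Y) C′
          ≡⟨ ℚP.*-comm (Mstar n r c C (∁ Y)) _ ⟩
        M n r c (∁ Y) C′ * Mstar n r c C (∁ Y)
          ≡⟨ cong₂ _*_ (M-∁ r c r′ c′ Y C′) (Mstar-complement r c n r≤c c≤n n≤r+c C Y ∣C∣≡c ∣Y∣≡c′) ⟩
        M n r′ c′ (∁ C′) Y * Mstar n r′ c′ Y (∁ C)
          ≡⟨ cong (if_then M n r′ c′ (∁ C′) Y * Mstar n r′ c′ Y (∁ C) else 0ℚ) (sym (dec-true (∣ Y ∣ ℕP.≟ c′) ∣Y∣≡c′)) ⟩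
        (if ∣ Y ∣ ≡ᵇ c′ then M n r′ c′ (∁ C′) Y * Mstar n r′ c′ Y (∁ C) else 0ℚ) ∎
        where
        ∣∁Y∣≡r : ∣ ∁ Y ∣ ≡ r
        ∣∁Y∣≡r = trans (∣∁p∣≡n∸∣p∣ Y) (trans (cong (n ∸_) ∣Y∣≡c′) (ℕP.m∸[m∸n]≡n r≤n))
      by-cases (no ∣Y∣≢c′) =
        trans (cong (if_then Mstar n r c C (∁ Y) * M n r c (∁ Y) C′ else 0ℚ) (dec-false (∣ ∁ Y ∣ ℕP.≟ r) ∣∁Y∣≢r))
              (cong (if_then M n r′ c′ (∁ C′) Y * Mstar n r′ c′ Y (∁ C) else 0ℚ) (sym (dec-false (∣ Y ∣ ℕP.≟ c′) ∣Y∣≢c′)))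
        where
        ∣∁Y∣≢r : ∣ ∁ Y ∣ ≢ r
        ∣∁Y∣≢r ∣∁Y∣≡r = ∣Y∣≢c′ (trans (sym (ℕP.m+n∸n≡m ∣ Y ∣ ∣ ∁ Y ∣)) (cong₂ _∸_ (∣p∣+∣∁p∣≡n Y) ∣∁Y∣≡r))


open Inverses using (MMstar≡δ; MstarM≡δ)
open import Data.Nat using (ℕ; _≤_; _+_)
open import Data.Fin.Subset using (Subset; ∣_∣)
open import Data.Product using (_×_; _,_)
open import Data.Rational using (_*_)

lemma2p2 : (r c n : ℕ) → r ≤ c → c ≤ n →
    ((r + c ≤ n) → (R R′ : Subset n) → ∣ R ∣ ≡ r → ∣ R′ ∣ ≡ r →
      sumOver n c (λ C → M n r c R C * Mstar n r c C R′) ≡ δ R R′)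
    ×
    ((n ≤ r + c) → (C C′ : Subset n) → ∣ C ∣ ≡ c → ∣ C′ ∣ ≡ c →
      sumOver n r (λ R → Mstar n r c C R * M n r c R C′) ≡ δ C C′)
lemma2p2 r c n r≤c c≤n = MMstar≡δ r c n r≤c , MstarM≡δ r c n r≤c c≤n
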